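{- Let $T$ be a tree of pairs $(u,v)$ with $u,v\in\omega^{<\omega}$ of equal length, closed under taking pairs of initial segments of equal length, and let $[T]=\{(x,y)\in\omega^\omega\times\omega^\omega:\forall n\ (x\upharpoonright n,y\upharpoonright n)\in T\}$. For $s,t\in\omega^{<\omega}$ let $A_{s,t}=\{x\in\omega^\omega: s\subseteq x \text{ and } \exists y\in\omega^\omega\,(t\subseteq y \wedge (x,y)\in[T])\}$. Let $s,t\in\omega^{<\omega}$ and suppose that $A_{s,t}\cap[H]\neq\emptyset$ for every Hechler tree $H$ with root $s$. Then there exist an infinite well-founded tree $S\subseteq\{r\in\omega^{<\omega}: s\subseteq r\}$ (closed under initial segments extending $s$) with root $s$, and with set of terminal nodes $B\subseteq S$, such that: (1) for every $r\in S\setminus B$ there are infinitely many $n$ with $rn\in S$; and (2) for every $r\in B$ there exists $n\in\omega$ such that $A_{r,tn}\cap[H]\neq\emptyset$ for every Hechler tree $H$ with root $r$.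
   Context: For $s\in\omega^{<\omega}$ and $n\in\omega$, $sn$ denotes the one-term extension of $s$ by $n$. A tree is well-founded if it has no infinite branch; its terminal nodes are those with no proper extension in the tree. For a tree $H\subseteq\omega^{<\omega}$ (nonempty, closed under initial segments), $[H]=\{x\in\omega^\omega:\forall n\ x\upharpoonright n\in H\}$. A tree $H\subseteq\omega^{<\omega}$ is a Hechler tree with root $s$ iff $s\in H$, every $r\in H$ satisfies $s\subseteq r$ or $r\subseteq s$, and for every $r\in H$ with $s\subseteq r$, $rn\in H$ for all but finitely many $n\in\omega$. -}

module Defs where

open import Data.Nat using (ℕ; _≤_)
open import Data.Bool using (Bool; true)
open import Data.List using (List; []; _∷_; _++_; map; upTo; length)
open import Data.List.Membership.Propositional using (_∈_)
open import Data.Product using (Σ; ∃; _×_)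
open import Data.Sum using (_⊎_)
open import Relation.Nullary using (¬_)
open import Relation.Binary.PropositionalEquality using (_≡_)

-- finite sequences: List ℕ ; infinite sequences: ℕ → ℕ
Seq : Set
Seq = List ℕ

Real : Set
Real = ℕ → ℕ

_≼_ : Seq → Seq → Set
s ≼ r = Σ Seq (λ u → s ++ u ≡ r)

_↾_ : Real → ℕ → Seq
x ↾ n = map x (upTo n)

_⊑_ : Seq → Real → Set
s ⊑ x = x ↾ length s ≡ s

_·_ : Seq → ℕ → Seq
s · n = s ++ (n ∷ [])

SeqSet : Set
SeqSet = Seq → Bool

_∈ˢ_ : Seq → SeqSet → Set
r ∈ˢ S = S r ≡ true

IsPairTree : (Seq → Seq → Set) → Set
IsPairTree T =
  (∀ u v → T u v → length u ≡ length v) ×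
  (∀ u v u′ v′ → u′ ≼ u → v′ ≼ v → length u′ ≡ length v′ → T u v → T u′ v′)

InBody : (Seq → Seq → Set) → Real → Real → Set
InBody T x y = ∀ n → T (x ↾ n) (y ↾ n)

A : (Seq → Seq → Set) → Seq → Seq → Real → Set
A T s t x = s ⊑ x × ∃ (λ y → t ⊑ y × InBody T x y)

InBranches : SeqSet → Real → Set
InBranches H x = ∀ n → (x ↾ n) ∈ˢ H

IsHechler : SeqSet → Seq → Set
IsHechler H s =
  (∀ r r′ → r′ ≼ r → r ∈ˢ H → r′ ∈ˢ H) ×
  (s ∈ˢ H) ×
  (∀ r → r ∈ˢ H → s ≼ r ⊎ r ≼ s) ×
  (∀ r → r ∈ˢ H → s ≼ r → ∃ (λ N → ∀ n → N ≤ n → (r · n) ∈ˢ H))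

Positive : (Seq → Seq → Set) → Seq → Seq → Set
Positive T s t = ∀ H → IsHechler H s → ∃ (λ x → A T s t x × InBranches H x)

Terminal : SeqSet → Seq → Set
Terminal S r = r ∈ˢ S × (∀ r′ → r′ ∈ˢ S → r ≼ r′ → r′ ≡ r)

FiniteSet : SeqSet → Set
FiniteSet S = ∃ (λ (L : List Seq) → ∀ r → r ∈ˢ S → r ∈ L)

IsRootedTreeAbove : SeqSet → Seq → Set
IsRootedTreeAbove S s =
  (∀ r → r ∈ˢ S → s ≼ r) ×
  (∀ r r′ → s ≼ r′ → r′ ≼ r → r ∈ˢ S → r′ ∈ˢ S) ×
  (s ∈ˢ S)

WellFoundedAbove : SeqSet → Seq → Set
WellFoundedAbove S s = ¬ ∃ (λ (x : Real) → ∀ n → length s ≤ n → (x ↾ n) ∈ˢ S)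

-- classical logic (the paper works in ZFC)
LEM : Set₁
LEM = (P : Set) → P ⊎ ¬ P

-- Call u good if, for some n, A_{u,tn} meets [H] for every Hechler tree H
-- with root u, and consider the inductive predicate Bar: u is barred if u is
-- good or infinitely many one-step extensions of u are barred. If infinitely
-- many sn are barred, a derivation of "s is barred" is a well-founded tree
-- whose inner nodes split infinitely and whose leaves are good: this is S.
-- Otherwise cofinitely many sn are not barred, and a node that is not barred
-- has cofinitely many non-barred children. Every non-barred r admits a
-- Hechler tree with root r that avoids A_{r,tm} (with m read off from the
-- height of r); fusing these trees along the non-barred nodes gives a Hechler
-- tree with root s. A point x of A_{s,t} on it, witnessed by y, then lies on
-- the tree chosen for r = x ↾ K, where K is the height that corresponds to
-- m = y(|t|), although x ∈ A_{r,tm}.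
module Submission where

open import Defs
open import Data.Nat using (ℕ; _≤_)
open import Data.List using (List)
open import Data.Product using (Σ; ∃; _×_)
open import Relation.Nullary using (¬_)

open import Data.Bool using (true)
open import Data.Empty using (⊥; ⊥-elim)
open import Data.List using ([]; _∷_; _++_; map; upTo; applyUpTo; length; inits)
open import Data.List.Membership.Propositional using (_∈_)
open import Data.List.Membership.Propositional.Properties using (∈-map⁺)
open import Data.List.Properties
  using (++-identityʳ; ++-assoc; ++-cancelˡ; ∷-injectiveˡ; ∷-injectiveʳ; length-++; length-map; length-upTo;
         map-upTo; map-++; upTo-∷ʳ)
open import Data.List.Relation.Unary.Any using (here; there)
open import Data.Maybe using (Maybe; just; nothing; Is-just)
import Data.Maybe.Relation.Unary.Any as MaybeAny
open import Data.Nat using (zero; suc; _+_; _∸_; _<_; _⊔_; _≤?_; _<?_; z≤n; s≤s)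
open import Data.Nat.ListAction using (sum)
open import Data.Nat.Properties
open import Data.Product using (_,_; proj₁; proj₂)
import Data.Product as Product
open import Data.Sum using (_⊎_; inj₁; inj₂; [_,_]′)
import Data.Sum as Sum
open import Data.Unit using (⊤; tt)
open import Function using (_∘_; const)
open import Relation.Nullary using (yes; no)
open import Relation.Nullary.Decidable using (isYes; fromSum; dec⇒maybe)
open import Relation.Binary.PropositionalEquality using (_≡_; _≢_; refl; sym; trans; cong; cong₂; subst; module ≡-Reasoning)

Cofinite : (ℕ → Set) → Set
Cofinite P = ∃ λ N → ∀ n → N ≤ n → P n

Unbounded : (ℕ → Set) → Set
Unbounded P = ∀ N → ∃ λ n → N ≤ n × P n

Cofinite-× : ∀ {P Q : ℕ → Set} → Cofinite P → Cofinite Q → Cofinite (λ n → P n × Q n)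
Cofinite-× (M , p) (N , q) =
  M ⊔ N , λ n M⊔N≤n → p n (≤-trans (m≤m⊔n M N) M⊔N≤n) , q n (≤-trans (m≤n⊔m M N) M⊔N≤n)

Cofinite-∀∈ : ∀ {A : Set} {P : A → ℕ → Set} (as : List A) →
              (∀ a → a ∈ as → Cofinite (P a)) → Cofinite (λ n → ∀ a → a ∈ as → P a n)
Cofinite-∀∈ [] _ = 0 , λ _ _ _ ()
Cofinite-∀∈ (a ∷ as) h with Cofinite-× (h a (here refl)) (Cofinite-∀∈ as (λ b b∈as → h b (there b∈as)))
... | N , both = N , λ where
  n N≤n _ (here refl)   → proj₁ (both n N≤n)
  n N≤n b (there b∈as) → proj₂ (both n N≤n) b b∈as

infix 4 _≺_

_≺_ : Seq → Seq → Set
r ≺ u = r ≼ u × length r < length u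

≼-refl : ∀ r → r ≼ r
≼-refl r = [] , ++-identityʳ r

≼-trans : ∀ {a b c} → a ≼ b → b ≼ c → a ≼ c
≼-trans {a} (u , refl) (v , refl) = u ++ v , sym (++-assoc a u v)

≼-· : ∀ r n → r ≼ (r · n)
≼-· r n = n ∷ [] , refl

∷-≼ : ∀ {x a b} → a ≼ b → (x ∷ a) ≼ (x ∷ b)
∷-≼ {x} (u , e) = u , cong (x ∷_) e

length-· : ∀ r n → length (r · n) ≡ suc (length r)
length-· r n = trans (length-++ r) (+-comm (length r) 1)

·≢ : ∀ r n → r · n ≢ r
·≢ r n e = 1+n≢n (trans (sym (length-· r n)) (cong length e))

≼⇒length≤ : ∀ {a b} → a ≼ b → length a ≤ length b
≼⇒length≤ {a} (u , refl) = subst (length a ≤_) (sym (length-++ a)) (m≤m+n _ _)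

≼∧length≥⇒≡ : ∀ {a b} → a ≼ b → length b ≤ length a → a ≡ b
≼∧length≥⇒≡ {a} ([] , refl) _ = sym (++-identityʳ a)
≼∧length≥⇒≡ {a} (x ∷ u , refl) b≤a =
  ⊥-elim (<⇒≱ (subst (length a <_) (sym (length-++ a)) (m<m+n (length a) (s≤s z≤n))) b≤a)

≼-comparable : ∀ {a b c} → a ≼ c → b ≼ c → a ≼ b ⊎ b ≼ a
≼-comparable {[]} {b} _ _ = inj₁ (b , refl)
≼-comparable {_ ∷ _} {[]} _ _ = inj₂ (_ , refl)
≼-comparable {x ∷ a} {y ∷ b} (u , refl) (v , e) with refl ← ∷-injectiveˡ e =
  Sum.map ∷-≼ ∷-≼ (≼-comparable (u , refl) (v , ∷-injectiveʳ e))

≼-·⁻ : ∀ {r u n} → r ≼ (u · n) → r ≼ u ⊎ r ≡ u · n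
≼-·⁻ {r} {u} {n} r≼un with ≼-comparable r≼un (≼-· u n)
... | inj₁ r≼u = inj₁ r≼u
... | inj₂ u≼r with length r ≤? length u
...   | yes r≤u = inj₁ (subst (_≼ u) (≼∧length≥⇒≡ u≼r r≤u) (≼-refl u))
...   | no r≰u = inj₂ (≼∧length≥⇒≡ r≼un (subst (_≤ length r) (sym (length-· u n)) (≰⇒> r≰u)))

≼⇒∈-inits : ∀ {r u} → r ≼ u → r ∈ inits u
≼⇒∈-inits {[]} _ = here refl
≼⇒∈-inits {x ∷ r} (q , refl) = there (∈-map⁺ (x ∷_) (≼⇒∈-inits (q , refl)))

length-↾ : ∀ x n → length (x ↾ n) ≡ n
length-↾ x n = trans (length-map x (upTo n)) (length-upTo n)

applyUpTo-+ : ∀ {A : Set} (f : ℕ → A) m k → applyUpTo f (m + k) ≡ applyUpTo f m ++ applyUpTo (λ i → f (m + i)) k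
applyUpTo-+ f zero k = refl
applyUpTo-+ f (suc m) k = cong (f 0 ∷_) (applyUpTo-+ (f ∘ suc) m k)

↾-+ : ∀ x m k → x ↾ (m + k) ≡ x ↾ m ++ (λ i → x (m + i)) ↾ k
↾-+ x m k = begin
  x ↾ (m + k)                                         ≡⟨ map-upTo x (m + k) ⟩
  applyUpTo x (m + k)                                 ≡⟨ applyUpTo-+ x m k ⟩
  applyUpTo x m ++ applyUpTo (λ i → x (m + i)) k      ≡⟨ sym (cong₂ _++_ (map-upTo x m) (map-upTo _ k)) ⟩
  x ↾ m ++ (λ i → x (m + i)) ↾ k                      ∎
  where open ≡-Reasoning

↾-· : ∀ x n → x ↾ suc n ≡ (x ↾ n) · x n
↾-· x n = trans (cong (map x) (sym (upTo-∷ʳ n))) (map-++ x (upTo n) (n ∷ []))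

↾-≼ : ∀ x {n K} → n ≤ K → (x ↾ n) ≼ (x ↾ K)
↾-≼ x {n} {K} n≤K = _ , trans (sym (↾-+ x n (K ∸ n))) (cong (x ↾_) (m+[n∸m]≡n n≤K))

unbounded-extensions⇒¬finite : ∀ {S : SeqSet} s → Unbounded (λ n → (s · n) ∈ˢ S) → ¬ FiniteSet S
unbounded-extensions⇒¬finite s unbounded (L , ⊆L) with unbounded (suc (sum (map sum L)))
... | n , bound<n , sn∈S = <⇒≱ bound<n (≤-trans (n≤sum-· s) (sum≤ (⊆L (s · n) sn∈S)))
  where
  n≤sum-· : ∀ r → n ≤ sum (r · n)
  n≤sum-· [] = m≤m+n n 0
  n≤sum-· (x ∷ r) = ≤-trans (n≤sum-· r) (m≤n+m _ x)
  sum≤ : ∀ {r L} → r ∈ L → sum r ≤ sum (map sum L)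
  sum≤ (here refl) = m≤m+n _ _
  sum≤ {L = q ∷ _} (there r∈L) = ≤-trans (sum≤ r∈L) (m≤n+m _ (sum q))

A-refine : ∀ T {s t x} → A T s t x → ∃ λ m → ∀ K → A T (x ↾ K) (t · m) x
A-refine T {t = t} {x} (_ , y , t⊑y , body) =
  y (length t) , λ K → cong (x ↾_) (length-↾ x K) , y , t·m⊑y , body
  where
  t·m⊑y : (t · y (length t)) ⊑ y
  t·m⊑y = trans (cong (y ↾_) (length-· t _)) (trans (↾-· y (length t)) (cong (_· y (length t)) t⊑y))

-- The children of a node are given as a partial function, so that a
-- derivation determines a tree.
data Bar (Good : Seq → Set) : Seq → Set where
  leaf : ∀ {u} → Good u → Bar Good u
  node : ∀ {u} (child : (n : ℕ) → Maybe (Bar Good (u · n))) →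
         Unbounded (λ n → Is-just (child n)) → Bar Good u

module _ {Good : Seq → Set} where

  infix 4 _∋_ _∋ᵐ_

  -- Paths of the derivation tree, relative to its root.
  mutual
    _∋_ : ∀ {u} → Bar Good u → Seq → Set
    _ ∋ [] = ⊤
    leaf _ ∋ _ ∷ _ = ⊥
    node child _ ∋ n ∷ p = child n ∋ᵐ p

    _∋ᵐ_ : ∀ {u} → Maybe (Bar Good u) → Seq → Set
    nothing ∋ᵐ _ = ⊥
    just w ∋ᵐ p = w ∋ p

  is-just⇒∋ᵐ[] : ∀ {u} {c : Maybe (Bar Good u)} → Is-just c → c ∋ᵐ []
  is-just⇒∋ᵐ[] (MaybeAny.just _) = tt

  mutual
    ∋-++⁻ˡ : ∀ {u} (w : Bar Good u) p {q} → w ∋ p ++ q → w ∋ p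
    ∋-++⁻ˡ _ [] _ = tt
    ∋-++⁻ˡ (node child _) (n ∷ p) h = ∋ᵐ-++⁻ˡ (child n) p h

    ∋ᵐ-++⁻ˡ : ∀ {u} (c : Maybe (Bar Good u)) p {q} → c ∋ᵐ p ++ q → c ∋ᵐ p
    ∋ᵐ-++⁻ˡ (just w) p h = ∋-++⁻ˡ w p h

  Outcome : Seq → (Seq → Set) → Seq → Set
  Outcome u Path p = (Good (u ++ p) × (∀ q → Path (p ++ q) → q ≡ [])) ⊎ Unbounded (λ n → Path (p · n))

  mutual
    ∋-outcome : ∀ {u} (w : Bar Good u) p → w ∋ p → Outcome u (w ∋_) p
    ∋-outcome {u} (leaf good) [] _ = inj₁ (subst Good (sym (++-identityʳ u)) good , maximal)
      where
      maximal : ∀ q → leaf good ∋ q → q ≡ []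
      maximal [] _ = refl
    ∋-outcome (node child unbounded) [] _ =
      inj₂ λ N → Product.map₂ (Product.map₂ is-just⇒∋ᵐ[]) (unbounded N)
    ∋-outcome {u} (node child _) (n ∷ p) h =
      Sum.map₁ (Product.map₁ (subst Good (++-assoc u (n ∷ []) p))) (∋ᵐ-outcome (child n) p h)

    ∋ᵐ-outcome : ∀ {u} (c : Maybe (Bar Good u)) p → c ∋ᵐ p → Outcome u (c ∋ᵐ_) p
    ∋ᵐ-outcome (just w) p h = ∋-outcome w p h

  mutual
    ∋-wellFounded : ∀ {u} (w : Bar Good u) x → ¬ (∀ k → w ∋ x ↾ k)
    ∋-wellFounded (leaf _) x h = h 1
    ∋-wellFounded w@(node child _) x h =
      ∋ᵐ-wellFounded (child (x 0)) (x ∘ suc) (λ k → subst (w ∋_) (↾-+ x 1 k) (h (suc k)))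

    ∋ᵐ-wellFounded : ∀ {u} (c : Maybe (Bar Good u)) x → ¬ (∀ k → c ∋ᵐ x ↾ k)
    ∋ᵐ-wellFounded nothing x h = h 0
    ∋ᵐ-wellFounded (just w) x h = ∋-wellFounded w x h

module Classical (lem : LEM) where

  setOf : (Seq → Set) → SeqSet
  setOf P r = isYes (fromSum (lem (P r)))

  ∈-setOf⁺ : ∀ P {r} → P r → r ∈ˢ setOf P
  ∈-setOf⁺ P {r} p with lem (P r)
  ... | inj₁ _ = refl
  ... | inj₂ ¬p = ⊥-elim (¬p p)

  ∈-setOf⁻ : ∀ P {r} → r ∈ˢ setOf P → P r
  ∈-setOf⁻ P {r} r∈P with lem (P r)
  ∈-setOf⁻ P _ | inj₁ p = p
  ∈-setOf⁻ P () | inj₂ _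

  -- Hilbert's ε with a default value for the case that nothing satisfies P.
  ε : {B : Set} → B → (B → Set) → B
  ε b P = [ proj₁ , const b ]′ (lem (∃ P))

  ε-spec : ∀ {B : Set} {b : B} {P : B → Set} → ∃ P → P (ε b P)
  ε-spec {b = b} {P} ∃P with lem (∃ P)
  ... | inj₁ (_ , p) = p
  ... | inj₂ ¬∃P = ⊥-elim (¬∃P ∃P)

  unbounded⊎cofinite-¬ : (P : ℕ → Set) → Unbounded P ⊎ Cofinite (λ n → ¬ P n)
  unbounded⊎cofinite-¬ P with lem (Cofinite (λ n → ¬ P n))
  ... | inj₁ cofinite = inj₂ cofinite
  ... | inj₂ ¬cofinite = inj₁ unbounded
    where
    unbounded : Unbounded P
    unbounded N with lem (∃ λ n → N ≤ n × P n)
    ... | inj₁ witness = witness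
    ... | inj₂ none = ⊥-elim (¬cofinite (N , λ n N≤n p → none (n , N≤n , p)))

  Cofinite-→ : ∀ {P : Set} {Q : ℕ → Set} → (P → Cofinite Q) → Cofinite (λ n → P → Q n)
  Cofinite-→ {P} h with lem P
  ... | inj₁ p = Product.map₂ (λ q n N≤n _ → q n N≤n) (h p)
  ... | inj₂ ¬p = 0 , λ _ _ p → ⊥-elim (¬p p)

  ¬Positive⇒avoiding-tree : ∀ {T r t} → ¬ Positive T r t →
    ∃ λ H → IsHechler H r × (∀ x → ¬ (A T r t x × InBranches H x))
  ¬Positive⇒avoiding-tree {T} {r} {t} ¬positive
    with lem (∃ λ H → IsHechler H r × (∀ x → ¬ (A T r t x × InBranches H x)))
  ... | inj₁ avoiding = avoiding
  ... | inj₂ none = ⊥-elim (¬positive positive)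
    where
    positive : Positive T r t
    positive H hechler with lem (∃ λ x → A T r t x × InBranches H x)
    ... | inj₁ meets = meets
    ... | inj₂ misses = ⊥-elim (none (H , hechler , λ x p → misses (x , p)))

  module _ {Good : Seq → Set} where

    Bar-node : ∀ {u} → Unbounded (λ n → Bar Good (u · n)) → Bar Good u
    Bar-node {u} unbounded =
      node (λ n → dec⇒maybe (fromSum (lem (Bar Good (u · n)))))
           (λ N → Product.map₂ (Product.map₂ is-just) (unbounded N))
      where
      is-just : ∀ {n} → Bar Good (u · n) → Is-just (dec⇒maybe (fromSum (lem (Bar Good (u · n)))))
      is-just {n} w with lem (Bar Good (u · n))
      ... | inj₁ _ = MaybeAny.just tt
      ... | inj₂ ¬w = ⊥-elim (¬w w)

    ¬Bar⇒cofinite-¬Bar : ∀ {u} → ¬ Bar Good u → Cofinite (λ n → ¬ Bar Good (u · n))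
    ¬Bar⇒cofinite-¬Bar {u} ¬bar with unbounded⊎cofinite-¬ (λ n → Bar Good (u · n))
    ... | inj₁ unbounded = ⊥-elim (¬bar (Bar-node unbounded))
    ... | inj₂ cofinite = cofinite

    module BarTree {s : Seq} (w : Bar Good s) where

      OnTree : Seq → Set
      OnTree r = ∃ λ p → s ++ p ≡ r × w ∋ p

      tree : SeqSet
      tree = setOf OnTree

      path : ∀ p {r} → s ++ p ≡ r → r ∈ˢ tree → w ∋ p
      path p refl r∈tree with ∈-setOf⁻ OnTree r∈tree
      ... | p′ , e , h = subst (w ∋_) (++-cancelˡ s p′ p e) h

      tree-rooted : IsRootedTreeAbove tree s
      tree-rooted = (λ r r∈tree → Product.map₂ proj₁ (∈-setOf⁻ OnTree r∈tree))
                  , closed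
                  , ∈-setOf⁺ OnTree ([] , ++-identityʳ s , tt)
        where
        closed : ∀ r r′ → s ≼ r′ → r′ ≼ r → r ∈ˢ tree → r′ ∈ˢ tree
        closed _ _ (p , refl) (q , refl) r∈tree =
          ∈-setOf⁺ OnTree (p , refl , ∋-++⁻ˡ w p (path (p ++ q) (sym (++-assoc s p q)) r∈tree))

      tree-wellFounded : WellFoundedAbove tree s
      tree-wellFounded (x , on-tree) = ∋-wellFounded w shifted shifted-on-path
        where
        shifted : Real
        shifted i = x (length s + i)
        x↾s≡s : x ↾ length s ≡ s
        x↾s≡s = sym (≼∧length≥⇒≡ (proj₁ tree-rooted _ (on-tree (length s) ≤-refl))
                                 (≤-reflexive (length-↾ x (length s))))
        shifted-on-path : ∀ k → w ∋ shifted ↾ k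
        shifted-on-path k = path (shifted ↾ k)
          (trans (cong (_++ shifted ↾ k) (sym x↾s≡s)) (sym (↾-+ x (length s) k)))
          (on-tree (length s + k) (m≤m+n _ _))

      tree-outcome : ∀ r → r ∈ˢ tree → (Terminal tree r × Good r) ⊎ Unbounded (λ n → (r · n) ∈ˢ tree)
      tree-outcome r r∈tree with ∈-setOf⁻ OnTree r∈tree
      ... | p , refl , h with ∋-outcome w p h
      ...   | inj₁ (good , maximal) = inj₁ ((r∈tree , terminal) , good)
        where
        terminal : ∀ r′ → r′ ∈ˢ tree → (s ++ p) ≼ r′ → r′ ≡ s ++ p
        terminal _ r′∈tree (q , refl) with maximal q (path (p ++ q) (sym (++-assoc s p q)) r′∈tree)
        ... | refl = ++-identityʳ (s ++ p)
      ...   | inj₂ unbounded = inj₂ λ N →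
        Product.map₂ (Product.map₂ (λ h′ → ∈-setOf⁺ OnTree (p · _ , sym (++-assoc s p _) , h′))) (unbounded N)

      tree-splits : ∀ r → r ∈ˢ tree → ¬ Terminal tree r → Unbounded (λ n → (r · n) ∈ˢ tree)
      tree-splits r r∈tree ¬terminal with tree-outcome r r∈tree
      ... | inj₁ (terminal , _) = ⊥-elim (¬terminal terminal)
      ... | inj₂ unbounded = unbounded

      tree-terminal-good : ∀ r → Terminal tree r → Good r
      tree-terminal-good r terminal with tree-outcome r (proj₁ terminal)
      ... | inj₁ (_ , good) = good
      ... | inj₂ unbounded with unbounded 0
      ... | n , _ , rn∈tree = ⊥-elim (·≢ r n (proj₂ terminal (r · n) rn∈tree (≼-· r n)))

    node-tree-splits-at-root : ∀ {s} child unbounded →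
      Unbounded (λ n → (s · n) ∈ˢ BarTree.tree (node {u = s} child unbounded))
    node-tree-splits-at-root child unbounded N with unbounded N
    ... | n , N≤n , child-n =
      n , N≤n , ∈-setOf⁺ (BarTree.OnTree (node child unbounded)) (n ∷ [] , refl , is-just⇒∋ᵐ[] child-n)

  module HechlerFusion (Bad : Seq → Set) (s : Seq) (H : Seq → SeqSet)
    (H-hechler : ∀ r → Bad r → IsHechler (H r) r)
    (bad-children : ∀ r → Bad r → Cofinite (λ n → Bad (r · n)))
    (s-bad-children : Cofinite (λ n → Bad (s · n))) where

    Fused : Seq → Set
    Fused u = u ≼ s ⊎ (s ≼ u × (∀ r → s ≺ r → r ≼ u → Bad r × u ∈ˢ H r))

    fusion : SeqSet
    fusion = setOf Fused

    ∈fusion⇒bad-below : ∀ {u} → u ∈ˢ fusion → ∀ r → s ≺ r → r ≼ u → Bad r × u ∈ˢ H r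
    ∈fusion⇒bad-below u∈fusion r s≺r@(_ , s<r) r≼u with ∈-setOf⁻ Fused u∈fusion
    ... | inj₁ u≼s = ⊥-elim (<⇒≱ s<r (≼⇒length≤ (≼-trans r≼u u≼s)))
    ... | inj₂ (_ , below) = below r s≺r r≼u

    ∈fusion⇒above : ∀ {u} → u ∈ˢ fusion → length s < length u → s ≼ u
    ∈fusion⇒above u∈fusion s<u with ∈-setOf⁻ Fused u∈fusion
    ... | inj₁ u≼s = ⊥-elim (<⇒≱ s<u (≼⇒length≤ u≼s))
    ... | inj₂ (s≼u , _) = s≼u

    fusion-closed : ∀ u u′ → u′ ≼ u → u ∈ˢ fusion → u′ ∈ˢ fusion
    fusion-closed u u′ u′≼u u∈fusion with ∈-setOf⁻ Fused u∈fusion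
    ... | inj₁ u≼s = ∈-setOf⁺ Fused (inj₁ (≼-trans u′≼u u≼s))
    ... | inj₂ (s≼u , below) with ≼-comparable u′≼u s≼u
    ...   | inj₁ u′≼s = ∈-setOf⁺ Fused (inj₁ u′≼s)
    ...   | inj₂ s≼u′ = ∈-setOf⁺ Fused (inj₂ (s≼u′ , below′))
      where
      below′ : ∀ r → s ≺ r → r ≼ u′ → Bad r × u′ ∈ˢ H r
      below′ r s≺r r≼u′ with below r s≺r (≼-trans r≼u′ u′≼u)
      ... | bad , u∈Hr = bad , proj₁ (H-hechler r bad) u u′ u′≼u u∈Hr

    fusion-extends : ∀ u → u ∈ˢ fusion → s ≼ u → Cofinite (λ n → (u · n) ∈ˢ fusion)
    fusion-extends u u∈fusion s≼u =
      Product.map₂ (λ good n N≤n → ∈-setOf⁺ Fused (inj₂ (≼-trans s≼u (≼-· u n) , below n (good n N≤n))))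
                   (Cofinite-× old-trees bad-child)
      where
      InOldTrees : ℕ → Set
      InOldTrees n = ∀ r → r ∈ inits u → s ≺ r × r ≼ u → (u · n) ∈ˢ H r
      old-trees : Cofinite InOldTrees
      old-trees = Cofinite-∀∈ (inits u) λ r _ → Cofinite-→ λ (s≺r , r≼u) →
        let bad , u∈Hr = ∈fusion⇒bad-below u∈fusion r s≺r r≼u
        in proj₂ (proj₂ (proj₂ (H-hechler r bad))) u u∈Hr r≼u
      bad-child : Cofinite (λ n → Bad (u · n))
      bad-child with length s <? length u
      ... | yes s<u = bad-children u (proj₁ (∈fusion⇒bad-below u∈fusion u (s≼u , s<u) (≼-refl u)))
      ... | no s≮u =
        subst (λ v → Cofinite (λ n → Bad (v · n))) (≼∧length≥⇒≡ s≼u (≮⇒≥ s≮u)) s-bad-children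
      below : ∀ n → InOldTrees n × Bad (u · n) → ∀ r → s ≺ r → r ≼ (u · n) → Bad r × (u · n) ∈ˢ H r
      below n (in-old , bad) r s≺r r≼un with ≼-·⁻ r≼un
      ... | inj₁ r≼u =
        proj₁ (∈fusion⇒bad-below u∈fusion r s≺r r≼u) , in-old r (≼⇒∈-inits r≼u) (s≺r , r≼u)
      ... | inj₂ refl = bad , proj₁ (proj₂ (H-hechler (u · n) bad))

    fusion-hechler : IsHechler fusion s
    fusion-hechler = fusion-closed
                   , ∈-setOf⁺ Fused (inj₁ (≼-refl s))
                   , (λ u u∈fusion → [ inj₂ , inj₁ ∘ proj₁ ]′ (∈-setOf⁻ Fused u∈fusion))
                   , fusion-extends

    fusion-branch : ∀ x → InBranches fusion x → ∀ K → length s < K →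
                    Bad (x ↾ K) × InBranches (H (x ↾ K)) x
    fusion-branch x on-fusion K s<K = proj₁ (at K ≤-refl) , on-H
      where
      s≺x↾K : s ≺ (x ↾ K)
      s≺x↾K = ∈fusion⇒above (on-fusion K) s<x↾K , s<x↾K
        where
        s<x↾K : length s < length (x ↾ K)
        s<x↾K = subst (length s <_) (sym (length-↾ x K)) s<K
      at : ∀ n → K ≤ n → Bad (x ↾ K) × (x ↾ n) ∈ˢ H (x ↾ K)
      at n K≤n = ∈fusion⇒bad-below (on-fusion n) (x ↾ K) s≺x↾K (↾-≼ x K≤n)
      on-H : InBranches (H (x ↾ K)) x
      on-H n with K ≤? n
      ... | yes K≤n = proj₂ (at n K≤n)
      ... | no K≰n = proj₁ (H-hechler (x ↾ K) (proj₁ (at K ≤-refl))) (x ↾ K) (x ↾ n)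
                       (↾-≼ x (<⇒≤ (≰⇒> K≰n))) (proj₂ (at K ≤-refl))

Good : (Seq → Seq → Set) → Seq → Seq → Set
Good T t r = ∃ λ n → Positive T r (t · n)

module _ (lem : LEM) (T : Seq → Seq → Set) (s t : Seq) where
  open Classical lem

  Bad : Seq → Set
  Bad r = ¬ Bar (Good T t) r

  -- A node r at height |s| + 1 + m is made to avoid A_{r,tm}.
  level : Seq → ℕ
  level r = length r ∸ suc (length s)

  Avoiding : Seq → SeqSet → Set
  Avoiding r H = IsHechler H r × (∀ x → ¬ (A T r (t · level r) x × InBranches H x))

  avoiding-tree : Seq → SeqSet
  avoiding-tree r = ε (const true) (Avoiding r)

  avoiding-tree-spec : ∀ r → Bad r → Avoiding r (avoiding-tree r)
  avoiding-tree-spec r bad = ε-spec (¬Positive⇒avoiding-tree {T = T} λ positive → bad (leaf (_ , positive)))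

  positive⇒¬cofinite-bad : Positive T s t → ¬ Cofinite (λ n → Bad (s · n))
  positive⇒¬cofinite-bad positive s-bad-children =
    let x , x∈A , on-fusion = positive fusion fusion-hechler in fusion-misses-A x on-fusion x∈A
    where
    open HechlerFusion Bad s avoiding-tree (λ r → proj₁ ∘ avoiding-tree-spec r)
                       (λ _ → ¬Bar⇒cofinite-¬Bar) s-bad-children

    fusion-misses-A : ∀ x → InBranches fusion x → ¬ A T s t x
    fusion-misses-A x on-fusion x∈A with A-refine T x∈A
    ... | m , refined with fusion-branch x on-fusion (suc (length s + m)) (s≤s (m≤m+n _ _))
    ... | bad , on-H =
      proj₂ (avoiding-tree-spec r bad) x (subst (λ j → A T r (t · j) x) (sym level-r) (refined K) , on-H)
      where
      K : ℕ
      K = suc (length s + m)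
      r : Seq
      r = x ↾ K
      level-r : level r ≡ m
      level-r = trans (cong (_∸ suc (length s)) (length-↾ x K)) (m+n∸m≡n (length s) m)

lemma6 : LEM → (T : Seq → Seq → Set) → IsPairTree T → (s t : Seq) →
    Positive T s t →
    ∃ (λ (S : SeqSet) →
    IsRootedTreeAbove S s ×
    WellFoundedAbove S s ×
    ¬ FiniteSet S ×
    (∀ r → r ∈ˢ S → ¬ Terminal S r → ∀ N → ∃ (λ n → N ≤ n × (r · n) ∈ˢ S)) ×
    (∀ r → Terminal S r → ∃ (λ n → Positive T r (t · n))))
lemma6 lem T _ s t positive
  with Classical.unbounded⊎cofinite-¬ lem (λ n → Bar (Good T t) (s · n))
... | inj₂ cofinite-bad = ⊥-elim (positive⇒¬cofinite-bad lem T s t positive cofinite-bad)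
... | inj₁ unbounded =
  tree , tree-rooted , tree-wellFounded , unbounded-extensions⇒¬finite s (node-tree-splits-at-root _ _) ,
  tree-splits , tree-terminal-good
  where
  open Classical lem
  open BarTree (Bar-node unbounded)
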